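{- Let $n$ and $d$ be positive integers with $n>2d$. (a) If $r$ is a non-negative integer and $\frac{n}{d}<\frac{2r+1}{r}$, then $K_{n/d}^{\,2r+1}$ is isomorphic to the circular complete graph $K_{n/((2r+1)d-rn)}$. (b) If $s$ is a non-negative integer, then $K_{n/d}$ and $K_{(2s+1)n/(sn+d)}^{\,2s+1}$ are homomorphically equivalent.
   Context: All graphs are finite. For positive integers $n\ge 2d$, the circular complete graph $K_{n/d}$ has vertex set $\{0,1,\dots,n-1\}$, with $ij$ an edge iff $d\le |i-j|\le n-d$. For a graph $G$ and a positive integer $k$, the $k$th power $G^{k}$ has vertex set $V(G)$, two vertices $u,v$ being adjacent iff there is a walk of length exactly $k$ between $u$ and $v$ in $G$. A homomorphism $G\to H$ is a map $V(G)\to V(H)$ sending edges to edges; $G$ and $H$ are homomorphically equivalent if $G\to H$ and $H\to G$. For $r=0$ the condition $\frac nd<\frac{2r+1}{r}$ is vacuous. -}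

module Defs where

open import Level using (Level; suc; _⊔_; zero)
open import Data.Nat as ℕ using (ℕ; _≤_; _∸_; ∣_-_∣)
open import Data.Fin using (Fin; toℕ)
open import Data.Product using (Σ; _×_; ∃)
open import Function.Bundles using (_⤖_; Bijection)

record Graph : Set₁ where
  field
    V : Set
    E : V → V → Set

open Graph public

K : ℕ → ℕ → Graph
V (K n d) = Fin n
E (K n d) i j = (d ≤ ∣ toℕ i - toℕ j ∣) × (∣ toℕ i - toℕ j ∣ ≤ n ∸ d)

data Walk (G : Graph) : ℕ → V G → V G → Set where
  here : ∀ {u} → Walk G 0 u u
  step : ∀ {k u w v} → E G u w → Walk G k w v → Walk G (ℕ.suc k) u v

_^_ : Graph → ℕ → Graph
V (G ^ k) = V G
E (G ^ k) u v = Walk G k u v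

Hom : Graph → Graph → Set
Hom G H = Σ (V G → V H) λ f → ∀ {u v} → E G u v → E H (f u) (f v)

HomEquiv : Graph → Graph → Set
HomEquiv G H = Hom G H × Hom H G

Iso : Graph → Graph → Set
Iso G H = Σ (V G ⤖ V H) λ f →
  ∀ u v → (E G u v → E H (Bijection.to f u) (Bijection.to f v))
        × (E H (Bijection.to f u) (Bijection.to f v) → E G u v)

module Submission where

-- Write u ⊕ s for the vertex (u + s) mod n. Then uv is an edge of K_{n/d} iff v = u ⊕ s for
-- some s ∈ [d, n − d], so, as 2d ≤ n, a walk of length k leads from u to v iff v = u ⊕ s for
-- some s ∈ [kd, k(n − d)]. For k = 2r + 1 and d′ = kd − rn this interval is
-- [rn + d′, rn + (n − d′)], and adding rn is invisible modulo n: K_{n/d}^{2r+1} and K_{n/d′}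
-- have the same edges. In (b) this gives K_{(2s+1)n/(sn+d)}^{2s+1} = K_{kn/kd} with k = 2s + 1,
-- which is homomorphically equivalent to K_{n/d} via i ↦ ki and x ↦ ⌊x/k⌋.

open import Defs
open import Data.Nat.Base using (ℕ; zero; suc; _+_; _*_; _∸_; _<_; _≤_; z≤n; ∣_-_∣; NonZero; >-nonZero)
open import Data.Nat.Properties
open import Data.Nat.DivMod
open import Data.Nat.Divisibility using (m∣m*n)
open import Data.Nat.Solver using (module +-*-Solver)
open import Data.Fin.Base using (Fin; toℕ; fromℕ<)
open import Data.Fin.Properties using (toℕ-injective; toℕ-fromℕ<; toℕ<n)
open import Data.Product using (_×_; ∃-syntax; ∃₂; _,_; proj₂)
open import Data.Sum using (_⊎_; inj₁; inj₂)
open import Function.Base using (id; _∘′_)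
open import Function.Bundles using (_⇔_; mk⇔; Equivalence)
open import Function.Construct.Identity using (⤖-id)
open import Function.Properties.Equivalence using () renaming (trans to ⇔-trans; sym to ⇔-sym)
open import Relation.Binary.Consequences using (wlog)
open import Relation.Binary.PropositionalEquality
open import Relation.Nullary.Decidable using (yes; no)
open +-*-Solver using (solve; _:+_; _:*_; _:=_; con)

private variable
  a b c d m n s x : ℕ

infix 4 _∈[_,_]

_∈[_,_] : ℕ → ℕ → ℕ → Set
x ∈[ a , b ] = a ≤ x × x ≤ b

∈[]-+ : x ∈[ a , b ] → m ∈[ c , d ] → x + m ∈[ a + c , b + d ]
∈[]-+ (a≤x , x≤b) (c≤m , m≤d) = +-mono-≤ a≤x c≤m , +-mono-≤ x≤b m≤d

∈[]-* : ∀ k → x ∈[ a , b ] → k * x ∈[ k * a , k * b ]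
∈[]-* k (a≤x , x≤b) = *-monoʳ-≤ k a≤x , *-monoʳ-≤ k x≤b

∈[]-split : a ≤ b → c ≤ d → s ∈[ a + c , b + d ] →
            ∃₂ λ x y → x ∈[ a , b ] × y ∈[ c , d ] × x + y ≡ s
∈[]-split {a} {b} {c} {d} {s} a≤b c≤d (lo , hi) with s ∸ c ≤? b
... | yes s∸c≤b =
  s ∸ c , c , (m+n≤o⇒m≤o∸n a lo , s∸c≤b) , (≤-refl , c≤d) , m∸n+n≡m (m+n≤o⇒n≤o a lo)
... | no s∸c≰b =
  b , s ∸ b , (a≤b , ≤-refl) , (c≤s∸b , m≤n+o⇒m∸n≤o s b hi) , m+[n∸m]≡n (m+n≤o⇒m≤o b b+c≤s)
  where
  b+c≤s : b + c ≤ s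
  b+c≤s = m≤o∸n⇒m+n≤o b (m+n≤o⇒n≤o a lo) (<⇒≤ (≰⇒> s∸c≰b))
  c≤s∸b : c ≤ s ∸ b
  c≤s∸b = m+n≤o⇒m≤o∸n c (subst (_≤ s) (+-comm b c) b+c≤s)

∈[]-reflect : x ∈[ d , n ∸ d ] → n ∸ x ∈[ d , n ∸ d ]
∈[]-reflect {x} {d} {n} (d≤x , x≤n∸d) =
  m+n≤o⇒m≤o∸n d (subst (_≤ n) (+-comm x d) (m≤o∸n⇒m+n≤o x d≤n x≤n∸d)) , ∸-monoʳ-≤ n d≤x
  where
  d≤n : d ≤ n
  d≤n = ≤-trans d≤x (≤-trans x≤n∸d (m∸n≤m n d))

odd*[n∸d]≡r*n+[n∸d′] : ∀ r {d′} → 2 * d ≤ n → (2 * r + 1) * d ≡ r * n + d′ →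
                        (2 * r + 1) * (n ∸ d) ≡ r * n + (n ∸ d′)
odd*[n∸d]≡r*n+[n∸d′] {d} {n} r {d′} 2d≤n kd≡rn+d′ = begin
  (2 * r + 1) * (n ∸ d)                ≡⟨ *-distribˡ-∸ (2 * r + 1) n d ⟩
  (2 * r + 1) * n ∸ (2 * r + 1) * d    ≡⟨ cong₂ _∸_ kn≡ kd≡rn+d′ ⟩
  (r * n + (r * n + n)) ∸ (r * n + d′) ≡⟨ [m+n]∸[m+o]≡n∸o (r * n) (r * n + n) d′ ⟩
  (r * n + n) ∸ d′                     ≡⟨ +-∸-assoc (r * n) d′≤n ⟩
  r * n + (n ∸ d′)                     ∎
  where
  open ≡-Reasoning
  kn≡ : (2 * r + 1) * n ≡ r * n + (r * n + n)
  kn≡ = solve 2 (λ r n → (con 2 :* r :+ con 1) :* n := r :* n :+ (r :* n :+ n)) refl r n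
  kd≡ : (2 * r + 1) * d ≡ r * (2 * d) + d
  kd≡ = solve 2 (λ r d → (con 2 :* r :+ con 1) :* d := r :* (con 2 :* d) :+ d) refl r d
  -- rn + d′ = (2r+1)d = r·2d + d ≤ rn + d, so d′ ≤ d ≤ n
  d′≤n : d′ ≤ n
  d′≤n = ≤-trans
    (+-cancelˡ-≤ (r * n) d′ d
      (subst (_≤ r * n + d) (trans (sym kd≡) kd≡rn+d′) (+-monoˡ-≤ d (*-monoʳ-≤ r 2d≤n))))
    (≤-trans (m≤m+n d (d + 0)) 2d≤n)

module _ {n : ℕ} .{{_ : NonZero n}} where

  infixl 6 _⊕_

  _⊕_ : Fin n → ℕ → Fin n
  u ⊕ s = fromℕ< (m%n<n (toℕ u + s) n)

  toℕ-⊕ : ∀ u s → toℕ (u ⊕ s) ≡ (toℕ u + s) % n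
  toℕ-⊕ u s = toℕ-fromℕ< (m%n<n (toℕ u + s) n)

  ⊕-identityʳ : ∀ u → u ⊕ 0 ≡ u
  ⊕-identityʳ u = toℕ-injective (begin
    toℕ (u ⊕ 0)     ≡⟨ toℕ-⊕ u 0 ⟩
    (toℕ u + 0) % n ≡⟨ cong (_% n) (+-identityʳ (toℕ u)) ⟩
    toℕ u % n       ≡⟨ m<n⇒m%n≡m (toℕ<n u) ⟩
    toℕ u           ∎)
    where open ≡-Reasoning

  ⊕-assoc : ∀ u s t → u ⊕ s ⊕ t ≡ u ⊕ (s + t)
  ⊕-assoc u s t = toℕ-injective (begin
    toℕ (u ⊕ s ⊕ t)                     ≡⟨ toℕ-⊕ (u ⊕ s) t ⟩
    (toℕ (u ⊕ s) + t) % n               ≡⟨ cong (λ z → (z + t) % n) (toℕ-⊕ u s) ⟩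
    ((toℕ u + s) % n + t) % n           ≡⟨ %-distribˡ-+ ((toℕ u + s) % n) t n ⟩
    ((toℕ u + s) % n % n + t % n) % n   ≡⟨ cong (λ z → (z + t % n) % n) (m%n%n≡m%n (toℕ u + s) n) ⟩
    ((toℕ u + s) % n + t % n) % n       ≡⟨ %-distribˡ-+ (toℕ u + s) t n ⟨
    (toℕ u + s + t) % n                 ≡⟨ cong (_% n) (+-assoc (toℕ u) s t) ⟩
    (toℕ u + (s + t)) % n               ≡⟨ toℕ-⊕ u (s + t) ⟨
    toℕ (u ⊕ (s + t))                   ∎)
    where open ≡-Reasoning

  ⊕-+-* : ∀ u r s → u ⊕ (r * n + s) ≡ u ⊕ s
  ⊕-+-* u r s = toℕ-injective (begin
    toℕ (u ⊕ (r * n + s))     ≡⟨ toℕ-⊕ u (r * n + s) ⟩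
    (toℕ u + (r * n + s)) % n ≡⟨ cong (_% n) (solve 4 (λ u r n s → u :+ (r :* n :+ s) := u :+ s :+ r :* n)
                                                       refl (toℕ u) r n s) ⟩
    (toℕ u + s + r * n) % n   ≡⟨ [m+kn]%n≡m%n (toℕ u + s) r n ⟩
    (toℕ u + s) % n           ≡⟨ toℕ-⊕ u s ⟨
    toℕ (u ⊕ s)               ∎)
    where open ≡-Reasoning

  ⊕-wrap : ∀ u s v → toℕ u + s ≡ toℕ v ⊎ toℕ u + s ≡ toℕ v + n → v ≡ u ⊕ s
  ⊕-wrap u s v u+s≡ = toℕ-injective (sym (begin
    toℕ (u ⊕ s)     ≡⟨ toℕ-⊕ u s ⟩
    (toℕ u + s) % n ≡⟨ reduce u+s≡ ⟩
    toℕ v % n       ≡⟨ m<n⇒m%n≡m (toℕ<n v) ⟩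
    toℕ v           ∎))
    where
    open ≡-Reasoning
    reduce : toℕ u + s ≡ toℕ v ⊎ toℕ u + s ≡ toℕ v + n → (toℕ u + s) % n ≡ toℕ v % n
    reduce (inj₁ eq) = cong (_% n) eq
    reduce (inj₂ eq) = trans (cong (_% n) eq) ([m+n]%n≡m%n (toℕ v) n)

  ⊕-unwrap : ∀ u s → s ≤ n → toℕ u + s ≡ toℕ (u ⊕ s) ⊎ toℕ u + s ≡ toℕ (u ⊕ s) + n
  ⊕-unwrap u s s≤n with toℕ u + s <? n
  ... | yes u+s<n = inj₁ (sym (trans (toℕ-⊕ u s) (m<n⇒m%n≡m u+s<n)))
  ... | no u+s≮n = inj₂ (begin
    toℕ u + s               ≡⟨ m∸n+n≡m n≤u+s ⟨
    toℕ u + s ∸ n + n       ≡⟨ cong (_+ n) (m<n⇒m%n≡m u+s∸n<n) ⟨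
    (toℕ u + s ∸ n) % n + n ≡⟨ cong (_+ n) (m≤n⇒[n∸m]%m≡n%m n≤u+s) ⟩
    (toℕ u + s) % n + n     ≡⟨ cong (_+ n) (toℕ-⊕ u s) ⟨
    toℕ (u ⊕ s) + n         ∎)
    where
    open ≡-Reasoning
    n≤u+s : n ≤ toℕ u + s
    n≤u+s = ≮⇒≥ u+s≮n
    u+s∸n<n : toℕ u + s ∸ n < n
    u+s∸n<n = +-cancelʳ-< _ _ n
      (subst (_< n + n) (sym (m∸n+n≡m n≤u+s)) (+-mono-<-≤ (toℕ<n u) s≤n))

  ShiftIn : ℕ → ℕ → Fin n → Fin n → Set
  ShiftIn a b u v = ∃[ s ] s ∈[ a , b ] × v ≡ u ⊕ s

  ⊕-∣-∣ : ∀ u v → v ≡ u ⊕ ∣ toℕ u - toℕ v ∣ ⊎ v ≡ u ⊕ (n ∸ ∣ toℕ u - toℕ v ∣)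
  ⊕-∣-∣ u v with ≤-total (toℕ u) (toℕ v)
  ... | inj₁ u≤v = inj₁ (⊕-wrap u _ v (inj₁ (begin
    toℕ u + ∣ toℕ u - toℕ v ∣ ≡⟨ cong (toℕ u +_) (m≤n⇒∣m-n∣≡n∸m u≤v) ⟩
    toℕ u + (toℕ v ∸ toℕ u)   ≡⟨ m+[n∸m]≡n u≤v ⟩
    toℕ v                     ∎)))
    where open ≡-Reasoning
  ... | inj₂ v≤u rewrite m≤n⇒∣n-m∣≡n∸m v≤u = inj₂ (⊕-wrap u _ v (inj₂ (begin
    toℕ u + (n ∸ δ)         ≡⟨ cong (_+ (n ∸ δ)) (m+[n∸m]≡n v≤u) ⟨
    toℕ v + δ + (n ∸ δ)     ≡⟨ +-assoc (toℕ v) δ (n ∸ δ) ⟩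
    toℕ v + (δ + (n ∸ δ))   ≡⟨ cong (toℕ v +_) (m+[n∸m]≡n δ≤n) ⟩
    toℕ v + n               ∎)))
    where
    open ≡-Reasoning
    δ : ℕ
    δ = toℕ u ∸ toℕ v
    δ≤n : δ ≤ n
    δ≤n = ≤-trans (m∸n≤m (toℕ u) (toℕ v)) (<⇒≤ (toℕ<n u))

  ∣-∣-⊕ : ∀ u s → s ≤ n → ∣ toℕ u - toℕ (u ⊕ s) ∣ ≡ s ⊎ ∣ toℕ u - toℕ (u ⊕ s) ∣ ≡ n ∸ s
  ∣-∣-⊕ u s s≤n with ⊕-unwrap u s s≤n
  ... | inj₁ u+s≡w = inj₁ (trans (cong (∣ toℕ u -_∣) (sym u+s≡w)) (∣m-m+n∣≡n (toℕ u) s))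
  ... | inj₂ u+s≡w+n = inj₂ (begin
    ∣ toℕ u - w ∣           ≡⟨ ∣-∣-comm (toℕ u) w ⟩
    ∣ w - toℕ u ∣           ≡⟨ cong (∣ w -_∣) u≡w+[n∸s] ⟩
    ∣ w - w + (n ∸ s) ∣     ≡⟨ ∣m-m+n∣≡n w (n ∸ s) ⟩
    n ∸ s                   ∎)
    where
    open ≡-Reasoning
    w : ℕ
    w = toℕ (u ⊕ s)
    u≡w+[n∸s] : toℕ u ≡ w + (n ∸ s)
    u≡w+[n∸s] = +-cancelʳ-≡ s _ _ (begin
      toℕ u + s           ≡⟨ u+s≡w+n ⟩
      w + n               ≡⟨ cong (w +_) (m∸n+n≡m s≤n) ⟨
      w + ((n ∸ s) + s)   ≡⟨ +-assoc w (n ∸ s) s ⟨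
      w + (n ∸ s) + s     ∎)

  edge⇔ShiftIn : ∀ {u v} → E (K n d) u v ⇔ ShiftIn d (n ∸ d) u v
  edge⇔ShiftIn {d} {u} {v} = mk⇔ to from
    where
    to : E (K n d) u v → ShiftIn d (n ∸ d) u v
    to uv with ⊕-∣-∣ u v
    ... | inj₁ v≡ = _ , uv , v≡
    ... | inj₂ v≡ = _ , ∈[]-reflect uv , v≡
    from : ShiftIn d (n ∸ d) u v → E (K n d) u v
    from (s , s∈ , refl) with ∣-∣-⊕ u s (≤-trans (proj₂ s∈) (m∸n≤m n d))
    ... | inj₁ ∣u-v∣≡s   = subst (_∈[ d , n ∸ d ]) (sym ∣u-v∣≡s) s∈
    ... | inj₂ ∣u-v∣≡n∸s = subst (_∈[ d , n ∸ d ]) (sym ∣u-v∣≡n∸s) (∈[]-reflect s∈)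

  ShiftIn-+-* : ∀ r {u v} → ShiftIn (r * n + a) (r * n + b) u v ⇔ ShiftIn a b u v
  ShiftIn-+-* {a} {b} r {u} {v} = mk⇔ to from
    where
    to : ShiftIn (r * n + a) (r * n + b) u v → ShiftIn a b u v
    to (s , (lo , hi) , v≡u⊕s) = t , (a≤t , m≤n+o⇒m∸n≤o s (r * n) hi) , (begin
      v               ≡⟨ v≡u⊕s ⟩
      u ⊕ s           ≡⟨ cong (u ⊕_) (m+[n∸m]≡n (m+n≤o⇒m≤o (r * n) lo)) ⟨
      u ⊕ (r * n + t) ≡⟨ ⊕-+-* u r t ⟩
      u ⊕ t           ∎)
      where
      open ≡-Reasoning
      t : ℕ
      t = s ∸ r * n
      a≤t : a ≤ t
      a≤t = m+n≤o⇒m≤o∸n a (subst (_≤ s) (+-comm (r * n) a) lo)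
    from : ShiftIn a b u v → ShiftIn (r * n + a) (r * n + b) u v
    from (t , (lo , hi) , v≡u⊕t) =
      r * n + t , (+-monoʳ-≤ (r * n) lo , +-monoʳ-≤ (r * n) hi) , trans v≡u⊕t (sym (⊕-+-* u r t))

  Walk→ShiftIn : ∀ k {u v} → Walk (K n d) k u v → ShiftIn (k * d) (k * (n ∸ d)) u v
  Walk→ShiftIn zero {u} here = 0 , (z≤n , z≤n) , sym (⊕-identityʳ u)
  Walk→ShiftIn (suc k) {u} {v} (step uw wv)
    with Equivalence.to edge⇔ShiftIn uw | Walk→ShiftIn k wv
  ... | x , x∈ , w≡u⊕x | y , y∈ , v≡w⊕y =
    x + y , ∈[]-+ x∈ y∈ , trans v≡w⊕y (trans (cong (_⊕ y) w≡u⊕x) (⊕-assoc u x y))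

  ShiftIn→Walk : d ≤ n ∸ d → ∀ k {u v} → ShiftIn (k * d) (k * (n ∸ d)) u v → Walk (K n d) k u v
  ShiftIn→Walk _ zero {u} (.0 , (_ , z≤n) , v≡u⊕0) =
    subst (Walk _ 0 u) (sym (trans v≡u⊕0 (⊕-identityʳ u))) here
  ShiftIn→Walk {d} d≤n∸d (suc k) {u} {v} (s , s∈ , v≡u⊕s)
    with ∈[]-split d≤n∸d (*-monoʳ-≤ k d≤n∸d) s∈
  ... | x , y , x∈ , y∈ , refl =
    step (Equivalence.from (edge⇔ShiftIn {u = u}) (x , x∈ , refl))
         (ShiftIn→Walk d≤n∸d k (y , y∈ , trans v≡u⊕s (sym (⊕-assoc u x y))))

  Walk⇔ShiftIn : d ≤ n ∸ d → ∀ k {u v} → Walk (K n d) k u v ⇔ ShiftIn (k * d) (k * (n ∸ d)) u v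
  Walk⇔ShiftIn d≤n∸d k = mk⇔ (Walk→ShiftIn k) (ShiftIn→Walk d≤n∸d k)

  K-power-odd⇔ : ∀ r {d′} → 2 * d ≤ n → (2 * r + 1) * d ≡ r * n + d′ →
                 ∀ {u v} → E (K n d ^ (2 * r + 1)) u v ⇔ E (K n d′) u v
  K-power-odd⇔ {d} r {d′} 2d≤n kd≡rn+d′ {u} {v} =
    ⇔-trans walk⇔ (⇔-trans (ShiftIn-+-* r) (⇔-sym edge⇔ShiftIn))
    where
    d≤n∸d : d ≤ n ∸ d
    d≤n∸d = m+n≤o⇒m≤o∸n d (subst (_≤ n) (cong (d +_) (+-identityʳ d)) 2d≤n)
    walk⇔ : E (K n d ^ (2 * r + 1)) u v ⇔ ShiftIn (r * n + d′) (r * n + (n ∸ d′)) u v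
    walk⇔ = subst₂ (λ a b → E (K n d ^ (2 * r + 1)) u v ⇔ ShiftIn a b u v)
                   kd≡rn+d′ (odd*[n∸d]≡r*n+[n∸d′] r 2d≤n kd≡rn+d′)
                   (Walk⇔ShiftIn d≤n∸d (2 * r + 1))

module _ (k : ℕ) .{{_ : NonZero k}} where

  [m+k*a]/k≡m/k+a : ∀ m a → (m + k * a) / k ≡ m / k + a
  [m+k*a]/k≡m/k+a m a = begin
    (m + k * a) / k   ≡⟨ +-distrib-/-∣ʳ m (m∣m*n a) ⟩
    m / k + k * a / k ≡⟨ cong (λ z → m / k + z / k) (*-comm k a) ⟩
    m / k + a * k / k ≡⟨ cong (m / k +_) (m*n/n≡m a k) ⟩
    m / k + a         ∎
    where open ≡-Reasoning

  [m+c]/k∸m/k∈[] : ∀ m c → c ∈[ k * a , k * b ] → (m + c) / k ∸ m / k ∈[ a , b ]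
  [m+c]/k∸m/k∈[] {a} {b} m c (lo , hi) =
    m+n≤o⇒m≤o∸n a (subst (_≤ (m + c) / k) (trans ([m+k*a]/k≡m/k+a m a) (+-comm (m / k) a))
                                          (/-monoˡ-≤ k (+-monoʳ-≤ m lo))) ,
    m≤n+o⇒m∸n≤o ((m + c) / k) (m / k) (subst ((m + c) / k ≤_) ([m+k*a]/k≡m/k+a m b)
                                          (/-monoˡ-≤ k (+-monoʳ-≤ m hi)))

  ∣-∣-/-∈[] : ∀ x y → ∣ x - y ∣ ∈[ k * a , k * b ] → ∣ x / k - y / k ∣ ∈[ a , b ]
  ∣-∣-/-∈[] {a} {b} = wlog ≤-total symmetric ordered
    where
    Q : ℕ → ℕ → Set
    Q x y = ∣ x - y ∣ ∈[ k * a , k * b ] → ∣ x / k - y / k ∣ ∈[ a , b ]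
    symmetric : ∀ {x y} → Q x y → Q y x
    symmetric {x} {y} = subst₂ (λ p q → p ∈[ k * a , k * b ] → q ∈[ a , b ])
                               (∣-∣-comm x y) (∣-∣-comm (x / k) (y / k))
    ordered : ∀ x y → x ≤ y → Q x y
    ordered x y x≤y
      rewrite m≤n⇒∣m-n∣≡n∸m x≤y | m≤n⇒∣m-n∣≡n∸m (/-monoˡ-≤ k x≤y) =
      subst (λ z → z / k ∸ x / k ∈[ a , b ]) (m+[n∸m]≡n x≤y) ∘′ [m+c]/k∸m/k∈[] x (y ∸ x)

  K-scale-hom : ∀ {n d} → Hom (K n d) (K (k * n) (k * d))
  K-scale-hom {n} {d} = scale , λ {i} {j} → subst₂ (λ z w → z ∈[ k * d , w ])
                                              (∣scale-scale∣ i j) (*-distribˡ-∸ k n d) ∘′ ∈[]-* k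
    where
    scale : Fin n → Fin (k * n)
    scale i = fromℕ< (*-monoʳ-< k (toℕ<n i))
    ∣scale-scale∣ : ∀ i j → k * ∣ toℕ i - toℕ j ∣ ≡ ∣ toℕ (scale i) - toℕ (scale j) ∣
    ∣scale-scale∣ i j = trans (*-distribˡ-∣-∣ k (toℕ i) (toℕ j))
      (sym (cong₂ ∣_-_∣ (toℕ-fromℕ< (*-monoʳ-< k (toℕ<n i))) (toℕ-fromℕ< (*-monoʳ-< k (toℕ<n j)))))

  K-unscale-hom : ∀ {n d} → Hom (K (k * n) (k * d)) (K n d)
  K-unscale-hom {n} {d} = unscale , λ {x} {y} →
    subst (_∈[ d , n ∸ d ]) (∣unscale-unscale∣ x y) ∘′ ∣-∣-/-∈[] (toℕ x) (toℕ y)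
      ∘′ subst (λ w → ∣ toℕ x - toℕ y ∣ ∈[ k * d , w ]) (sym (*-distribˡ-∸ k n d))
    where
    x/k<n : ∀ (x : Fin (k * n)) → toℕ x / k < n
    x/k<n x = m<n*o⇒m/o<n (subst (toℕ x <_) (*-comm k n) (toℕ<n x))
    unscale : Fin (k * n) → Fin n
    unscale x = fromℕ< (x/k<n x)
    ∣unscale-unscale∣ : ∀ x y → ∣ toℕ x / k - toℕ y / k ∣ ≡ ∣ toℕ (unscale x) - toℕ (unscale y) ∣
    ∣unscale-unscale∣ x y = sym (cong₂ ∣_-_∣ (toℕ-fromℕ< (x/k<n x)) (toℕ-fromℕ< (x/k<n y)))

Hom-trans : ∀ {G H I} → Hom G H → Hom H I → Hom G I
Hom-trans (f , f-hom) (g , g-hom) = (λ u → g (f u)) , λ e → g-hom (f-hom e)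

lemma1 : (n d : ℕ) → 1 ≤ d → 2 * d < n →
    ((r : ℕ) → r * n < (2 * r + 1) * d →
      Iso (K n d ^ (2 * r + 1)) (K n ((2 * r + 1) * d ∸ r * n)))
    × ((s : ℕ) → HomEquiv (K n d) (K ((2 * s + 1) * n) (s * n + d) ^ (2 * s + 1)))
lemma1 zero d _ ()
lemma1 n@(suc _) d _ 2d<n = powerIso , powerEquiv
  where
  2d≤n : 2 * d ≤ n
  2d≤n = <⇒≤ 2d<n

  powerIso : ∀ r → r * n < (2 * r + 1) * d → Iso (K n d ^ (2 * r + 1)) (K n ((2 * r + 1) * d ∸ r * n))
  powerIso r rn<kd = ⤖-id _ , λ u v → Equivalence.to edges⇔ , Equivalence.from edges⇔
    where
    edges⇔ : ∀ {u v} → E (K n d ^ (2 * r + 1)) u v ⇔ E (K n ((2 * r + 1) * d ∸ r * n)) u v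
    edges⇔ = K-power-odd⇔ r 2d≤n (sym (m+[n∸m]≡n (<⇒≤ rn<kd)))

  powerEquiv : ∀ s → HomEquiv (K n d) (K ((2 * s + 1) * n) (s * n + d) ^ (2 * s + 1))
  powerEquiv s = Hom-trans {K n d} {K (k * n) (k * d)} {power} (K-scale-hom k) from-scaled
               , Hom-trans {power} {K (k * n) (k * d)} {K n d} to-scaled (K-unscale-hom k)
    where
    k : ℕ
    k = 2 * s + 1
    instance
      k≢0 : NonZero k
      k≢0 = >-nonZero (m≤n+m 1 (2 * s))
      kn≢0 : NonZero (k * n)
      kn≢0 = m*n≢0 k n
    2D≤N : 2 * (s * n + d) ≤ k * n
    2D≤N = subst₂ _≤_
      (solve 3 (λ s n d → con 2 :* s :* n :+ con 2 :* d := con 2 :* (s :* n :+ d)) refl s n d)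
      (solve 2 (λ s n → con 2 :* s :* n :+ n := (con 2 :* s :+ con 1) :* n) refl s n)
      (+-monoʳ-≤ (2 * s * n) 2d≤n)
    kD≡sN+kd : k * (s * n + d) ≡ s * (k * n) + k * d
    kD≡sN+kd = solve 3 (λ s n d → (con 2 :* s :+ con 1) :* (s :* n :+ d)
                                  := s :* ((con 2 :* s :+ con 1) :* n) :+ (con 2 :* s :+ con 1) :* d)
                       refl s n d
    edges⇔ : ∀ {x y} → E (K (k * n) (s * n + d) ^ k) x y ⇔ E (K (k * n) (k * d)) x y
    edges⇔ = K-power-odd⇔ s 2D≤N kD≡sN+kd
    power : Graph
    power = K (k * n) (s * n + d) ^ k
    to-scaled : Hom power (K (k * n) (k * d))
    to-scaled = id , Equivalence.to edges⇔
    from-scaled : Hom (K (k * n) (k * d)) power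
    from-scaled = id , Equivalence.from edges⇔
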